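{- Let $S_\Delta$ be any one of the proof systems $\mathbb{K}^\Delta,\mathbb{KT}^\Delta,\mathbb{K4}^\Delta,\mathbb{K5}^\Delta,\mathbb{KB}^\Delta,\mathbb{S4}^\Delta,\mathbb{S5}^\Delta,\mathbb{K45}^\Delta$ for $\mathcal{L}_\Delta$, and let $S_D$ be $S_\Delta$ extended by the axiom schemas $\mathtt{D}_n$ for all $n\ge1$. If $S_\Delta$ is sound and strongly complete with respect to a class $F$ of frames, then $S_D$ is sound and strongly complete (for $\mathcal{L}_D$) with respect to $F$.
   Context: A frame is $\langle W,R\rangle$ with $W$ nonempty and $R\subseteq W\times W$ arbitrary; a model adds a valuation. $\mathcal{L}_D$: $A::=p\mid\neg A\mid A\land A\mid D(A_1,\dots,A_n;A)$ ($n\in\mathbb{N}$), with $D(A_1,\dots,A_n;B)$ true at $w$ iff for all $u,v$ with $wRu,wRv$, if $u,v$ agree on the truth of each $A_i$ then they agree on the truth of $B$. $\Delta B$ denotes $D(\,;B)$; $\mathcal{L}_\Delta$ is the fragment with only $\Delta$. For $T\subseteq\{1,\dots,n\}$, $B_T=C_1\land\cdots\land C_n$ with $C_i=A_i$ if $i\in T$, $\neg A_i$ otherwise. Axiom $\mathtt{D}_n$: $D(A_1,\dots,A_n;B)\leftrightarrow\bigwedge_{T\subseteq\{1,\dots,n\}}(\Delta(B_T\to B)\vee\Delta(B_T\to\neg B))$. System $\mathbb{K}^\Delta$: all tautologies; $\Delta(A\to B)\land\Delta(\neg A\to B)\to\Delta B$; $\Delta A\to\Delta(A\to B)\vee\Delta(\neg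 A\to C)$; $\Delta A\leftrightarrow\Delta\neg A$; rules modus ponens, from $A$ infer $\Delta A$, from $A\leftrightarrow B$ infer $\Delta A\leftrightarrow\Delta B$. $\mathbb{KT}^\Delta$ adds $\mathtt{T}$: $\Delta A\land\Delta(A\to B)\land A\to\Delta B$; $\mathbb{K4}^\Delta$ adds $\mathtt{4}$: $\Delta A\to\Delta(\Delta A\vee B)$; $\mathbb{K5}^\Delta$ adds $\mathtt{5}$: $\neg\Delta A\to\Delta(\neg\Delta A\vee B)$; $\mathbb{KB}^\Delta$ adds $A\to\Delta((\Delta A\land\Delta(A\to B)\land\neg\Delta B)\to C)$; $\mathbb{S4}^\Delta$ adds $\mathtt{T}$ and $\Delta A\to\Delta\Delta A$; $\mathbb{S5}^\Delta$ adds $\mathtt{T}$ and $\neg\Delta A\to\Delta\neg\Delta A$; $\mathbb{K45}^\Delta$ adds $\mathtt{4}$ and $\mathtt{5}$. A system is sound and strongly complete w.r.t. $F$ if for every set $\Gamma$ of formulas and formula $A$ of its language, $\Gamma\vdash A$ iff $\Gamma\vDash_F A$, where $\Gamma\vDash_F A$ means: at every world of every model based on a frame in $F$ where all of $\Gamma$ holds, $A$ holds. -}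

module Defs where

open import Level using (0ℓ)
open import Data.Nat using (ℕ)
open import Data.Bool using (Bool; true; false; not; _∧_)
open import Data.Product using (Σ; _×_)
open import Data.Unit using (⊤)
open import Data.List using (List; []; _∷_; foldr)
open import Data.List.NonEmpty as L⁺ using (List⁺; _∷⁺_; _⁺++⁺_; foldr₁)
  renaming ([_] to [_]⁺)
open import Data.List.Relation.Unary.All using (All)
open import Relation.Nullary using (¬_)
open import Relation.Binary.PropositionalEquality using (_≡_)
open import Function.Bundles using (_⇔_)

infixr 6 _&_
infix 7 ~_

data Fm : Set where
  var : ℕ → Fm
  ~_  : Fm → Fm
  _&_ : Fm → Fm → Fm
  D   : List Fm → Fm → Fm

Δ : Fm → Fm
Δ B = D [] B

infixr 5 _∨_
infixr 4 _⊃_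
infix 3 _≣_

_∨_ : Fm → Fm → Fm
A ∨ B = ~ (~ A & ~ B)

_⊃_ : Fm → Fm → Fm
A ⊃ B = ~ (A & ~ B)

_≣_ : Fm → Fm → Fm
A ≣ B = (A ⊃ B) & (B ⊃ A)

data InΔ : Fm → Set where
  var : ∀ p → InΔ (var p)
  ~_  : ∀ {A} → InΔ A → InΔ (~ A)
  _&_ : ∀ {A B} → InΔ A → InΔ B → InΔ (A & B)
  Δ∈  : ∀ {B} → InΔ B → InΔ (Δ B)

record Frame : Set₁ where
  field
    W : Set
    R : W → W → Set

module _ (fr : Frame) (V : Frame.W fr → ℕ → Set) where
  open Frame fr

  _↔_ : Set → Set → Set
  P ↔ Q = (P → Q) × (Q → P)

  mutual
    sat : Fm → W → Set
    sat (var p) w = V w p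
    sat (~ A) w = ¬ sat A w
    sat (A & B) w = sat A w × sat B w
    sat (D As B) w = ∀ u v → R w u → R w v → agree As u v → (sat B u ↔ sat B v)

    agree : List Fm → W → W → Set
    agree [] u v = ⊤
    agree (A ∷ As) u v = (sat A u ↔ sat A v) × agree As u v

_⊨[_]_ : (Fm → Set) → (Frame → Set₁) → Fm → Set₁
Γ ⊨[ F ] A = ∀ (fr : Frame) → F fr → ∀ (V : Frame.W fr → ℕ → Set) (w : Frame.W fr) →
  (∀ B → Γ B → sat fr V B w) → sat fr V A w

-- propositional tautologies (modal subformulas treated as atoms)
Taut : Fm → Set
Taut A = ∀ (v : Fm → Bool) → (∀ B → v (~ B) ≡ not (v B)) →
  (∀ B C → v (B & C) ≡ (v B ∧ v C)) → v A ≡ true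

data Logic : Set where
  K KT K4 K5 KB S4 S5 K45 : Logic

data Extra : Set where
  axT ax4 ax5 axB ax4' ax5' : Extra

data Has : Logic → Extra → Set where
  KT-T  : Has KT axT
  K4-4  : Has K4 ax4
  K5-5  : Has K5 ax5
  KB-B  : Has KB axB
  S4-T  : Has S4 axT
  S4-4' : Has S4 ax4'
  S5-T  : Has S5 axT
  S5-5' : Has S5 ax5'
  K45-4 : Has K45 ax4
  K45-5 : Has K45 ax5

-- B_T for all T ⊆ {1,…,n}: all lists of literals C₁,…,Cₙ (n ≥ 1)
choices : Fm → List Fm → List⁺ (List⁺ Fm)
choices A [] = [ [ A ]⁺ ]⁺ ⁺++⁺ [ [ ~ A ]⁺ ]⁺
choices A (A' ∷ As) =
  L⁺.map (A ∷⁺_) (choices A' As) ⁺++⁺ L⁺.map ((~ A) ∷⁺_) (choices A' As)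

-- axiom D_n for the list A ∷ As (so n ≥ 1)
Dax : Fm → List Fm → Fm → Fm
Dax A As B = D (A ∷ As) B ≣
  foldr₁ _&_ (L⁺.map (λ C → Δ (foldr₁ _&_ C ⊃ B) ∨ Δ (foldr₁ _&_ C ⊃ ~ B)) (choices A As))

-- axioms of S_Δ (withD = false) / S_D (withD = true)
data Ax (L : Logic) (withD : Bool) : Fm → Set where
  taut : ∀ {A} → Taut A → Ax L withD A
  k1 : ∀ A B → Ax L withD ((Δ (A ⊃ B) & Δ (~ A ⊃ B)) ⊃ Δ B)
  k2 : ∀ A B C → Ax L withD (Δ A ⊃ (Δ (A ⊃ B) ∨ Δ (~ A ⊃ C)))
  k3 : ∀ A → Ax L withD (Δ A ≣ Δ (~ A))
  T  : Has L axT → ∀ A B → Ax L withD (((Δ A & Δ (A ⊃ B)) & A) ⊃ Δ B)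
  A4 : Has L ax4 → ∀ A B → Ax L withD (Δ A ⊃ Δ (Δ A ∨ B))
  A5 : Has L ax5 → ∀ A B → Ax L withD (~ Δ A ⊃ Δ (~ Δ A ∨ B))
  AB : Has L axB → ∀ A B C → Ax L withD (A ⊃ Δ (((Δ A & Δ (A ⊃ B)) & ~ Δ B) ⊃ C))
  A4' : Has L ax4' → ∀ A → Ax L withD (Δ A ⊃ Δ (Δ A))
  A5' : Has L ax5' → ∀ A → Ax L withD (~ Δ A ⊃ Δ (~ Δ A))
  Dn : withD ≡ true → ∀ A As B → Ax L withD (Dax A As B)

Lang : Bool → Fm → Set
Lang false = InΔ
Lang true  = λ _ → ⊤

data Thm (L : Logic) (withD : Bool) : Fm → Set where
  ax  : ∀ {A} → Ax L withD A → Lang withD A → Thm L withD A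
  mp  : ∀ {A B} → Thm L withD A → Thm L withD (A ⊃ B) → Thm L withD B
  nec : ∀ {A} → Thm L withD A → Thm L withD (Δ A)
  re  : ∀ {A B} → Thm L withD (A ≣ B) → Thm L withD (Δ A ≣ Δ B)

Der : Logic → Bool → (Fm → Set) → Fm → Set
Der L withD Γ A = Σ (List Fm) λ Γ₀ → All Γ Γ₀ × Thm L withD (foldr _⊃_ A Γ₀)

SoundStrongComplΔ : Logic → (Frame → Set₁) → Set₁
SoundStrongComplΔ L F = ∀ (Γ : Fm → Set) (A : Fm) → (∀ B → Γ B → InΔ B) → InΔ A →
  Der L false Γ A ⇔ (Γ ⊨[ F ] A)

SoundStrongComplD : Logic → (Frame → Set₁) → Set₁
SoundStrongComplD L F = ∀ (Γ : Fm → Set) (A : Fm) → Der L true Γ A ⇔ (Γ ⊨[ F ] A)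

-- Every D-formula is provably equivalent in S_D to an L_Δ-formula: D_n rewrites D(A₁,…,Aₙ;B)
-- into its right-hand side, and replacement of equivalents works in S_D. Completeness of S_D
-- therefore reduces to completeness of S_Δ for the translated premises and conclusion.
-- Soundness reduces to soundness of S_Δ because every S_Δ axiom instance is a substitution
-- instance of an L_Δ axiom, while D_n is valid on all frames: each choice B_T pins down the
-- truth values of A₁,…,Aₙ, and every world satisfies some B_T. Excluded middle enters only
-- on the semantic side: to evaluate formulas as booleans and to find the B_T a world satisfies.
module Submission where

open import Defs
open import Level using (0ℓ)
open import Axiom.ExcludedMiddle using (ExcludedMiddle)
open import Data.Nat using (ℕ; zero; suc)
open import Data.Fin using (Fin; zero; suc)
open import Data.Bool using (Bool; true; false; not; _∧_) renaming (T to Tᵇ)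
open import Data.Bool.Properties using (T-≡; T-∧)
open import Data.Vec as Vec using (Vec; []; _∷_; lookup)
open import Data.Vec.Properties using (lookup-map)
open import Data.Product using (Σ; _×_; _,_; proj₁; proj₂)
open import Data.Product.Function.NonDependent.Propositional using (_×-⇔_)
open import Data.Unit using (tt)
open import Data.Empty using (⊥; ⊥-elim)
open import Data.List as List using (List; []; _∷_; foldr)
open import Data.List.NonEmpty as List⁺ using (List⁺; foldr₁; toList)
open import Data.List.Relation.Unary.All as All using (All; []; _∷_)
import Data.List.Relation.Unary.All.Properties as AllP
open import Data.List.Relation.Unary.Any as Any using (Any; here; there)
import Data.List.Relation.Unary.Any.Properties as AnyP
open import Data.List.Relation.Binary.Pointwise as Pointwise using (Pointwise; []; _∷_)
open import Relation.Nullary using (¬_; yes; no)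
open import Relation.Nullary.Decidable using (isYes; toWitness; decidable-stable)
open import Relation.Binary.PropositionalEquality using (_≡_; refl; sym; trans; cong; cong₂)
open import Function using (_∘_)
open import Function.Bundles using (_⇔_; Equivalence; mk⇔)
import Function.Properties.Equivalence as ⇔

open Equivalence using (to; from)

-- Propositional tautologies by truth tables

infix 7 ¬ₚ_
infixr 6 _∧ₚ_
infixr 4 _⇒ₚ_
infix 3 _⇔ₚ_

data Prop (n : ℕ) : Set where
  atom : Fin n → Prop n
  ¬ₚ_  : Prop n → Prop n
  _∧ₚ_ : Prop n → Prop n → Prop n

_⇒ₚ_ : ∀ {n} → Prop n → Prop n → Prop n
φ ⇒ₚ ψ = ¬ₚ (φ ∧ₚ ¬ₚ ψ)

_⇔ₚ_ : ∀ {n} → Prop n → Prop n → Prop n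
φ ⇔ₚ ψ = (φ ⇒ₚ ψ) ∧ₚ (ψ ⇒ₚ φ)

p₀ : ∀ {n} → Prop (suc n)
p₀ = atom zero

p₁ : ∀ {n} → Prop (suc (suc n))
p₁ = atom (suc zero)

p₂ : ∀ {n} → Prop (suc (suc (suc n)))
p₂ = atom (suc (suc zero))

p₃ : ∀ {n} → Prop (suc (suc (suc (suc n))))
p₃ = atom (suc (suc (suc zero)))

instantiate : ∀ {n} → Prop n → Vec Fm n → Fm
instantiate (atom i)  ρ = lookup ρ i
instantiate (¬ₚ φ)    ρ = ~ instantiate φ ρ
instantiate (φ ∧ₚ ψ)  ρ = instantiate φ ρ & instantiate ψ ρ

evaluate : ∀ {n} → Prop n → Vec Bool n → Bool
evaluate (atom i) bs = lookup bs i
evaluate (¬ₚ φ)   bs = not (evaluate φ bs)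
evaluate (φ ∧ₚ ψ) bs = evaluate φ bs ∧ evaluate ψ bs

evaluate-instantiate : (v : Fm → Bool) → (∀ B → v (~ B) ≡ not (v B)) →
  (∀ B C → v (B & C) ≡ (v B ∧ v C)) →
  ∀ {n} (φ : Prop n) ρ → v (instantiate φ ρ) ≡ evaluate φ (Vec.map v ρ)
evaluate-instantiate v v~ v& (atom i) ρ = sym (lookup-map i v ρ)
evaluate-instantiate v v~ v& (¬ₚ φ) ρ =
  trans (v~ _) (cong not (evaluate-instantiate v v~ v& φ ρ))
evaluate-instantiate v v~ v& (φ ∧ₚ ψ) ρ =
  trans (v& _ _) (cong₂ _∧_ (evaluate-instantiate v v~ v& φ ρ) (evaluate-instantiate v v~ v& ψ ρ))

allRows : ∀ n → (Vec Bool n → Bool) → Bool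
allRows zero    f = f []
allRows (suc n) f = allRows n (f ∘ (true ∷_)) ∧ allRows n (f ∘ (false ∷_))

allRows-sound : ∀ n f → Tᵇ (allRows n f) → ∀ bs → Tᵇ (f bs)
allRows-sound zero    f h []           = h
allRows-sound (suc n) f h (true ∷ bs)  = allRows-sound n _ (proj₁ (to T-∧ h)) bs
allRows-sound (suc n) f h (false ∷ bs) = allRows-sound n _ (proj₂ (to T-∧ h)) bs

taut-instance : ∀ {n} (φ : Prop n) ρ → Tᵇ (allRows n (evaluate φ)) → Taut (instantiate φ ρ)
taut-instance φ ρ h v v~ v& =
  trans (evaluate-instantiate v v~ v& φ ρ) (to T-≡ (allRows-sound _ _ h (Vec.map v ρ)))

-- Replacement of provable equivalents in S_D

conj : List⁺ Fm → Fm
conj = foldr₁ _&_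

decides : Fm → List⁺ Fm → Fm
decides B C = Δ (conj C ⊃ B) ∨ Δ (conj C ⊃ ~ B)

Dreduct : Fm → List Fm → Fm → Fm
Dreduct A As B = conj (List⁺.map (decides B) (choices A As))

module Provable (L : Logic) where

  ⊢_ : Fm → Set
  ⊢ X = Thm L true X

  tautology : ∀ {X} → Taut X → ⊢ X
  tautology t = ax (taut t) tt

  infix 4 _≈_
  _≈_ : Fm → Fm → Set
  X ≈ Y = ⊢ (X ≣ Y)

  ≈-refl : ∀ {X} → X ≈ X
  ≈-refl {X} = tautology (taut-instance (p₀ ⇔ₚ p₀) (X ∷ []) tt)

  ≈-trans : ∀ {X Y Z} → X ≈ Y → Y ≈ Z → X ≈ Z
  ≈-trans {X} {Y} {Z} e f = mp f (mp e (tautology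
    (taut-instance ((p₀ ⇔ₚ p₁) ⇒ₚ (p₁ ⇔ₚ p₂) ⇒ₚ (p₀ ⇔ₚ p₂)) (X ∷ Y ∷ Z ∷ []) tt)))

  ≈-~ : ∀ {X Y} → X ≈ Y → ~ X ≈ ~ Y
  ≈-~ {X} {Y} e = mp e (tautology
    (taut-instance ((p₀ ⇔ₚ p₁) ⇒ₚ (¬ₚ p₀ ⇔ₚ ¬ₚ p₁)) (X ∷ Y ∷ []) tt))

  ≈-& : ∀ {X X' Y Y'} → X ≈ X' → Y ≈ Y' → X & Y ≈ X' & Y'
  ≈-& {X} {X'} {Y} {Y'} e f = mp f (mp e (tautology
    (taut-instance ((p₀ ⇔ₚ p₁) ⇒ₚ (p₂ ⇔ₚ p₃) ⇒ₚ (p₀ ∧ₚ p₂ ⇔ₚ p₁ ∧ₚ p₃))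
                   (X ∷ X' ∷ Y ∷ Y' ∷ []) tt)))

  ≈-⊃ : ∀ {X X' Y Y'} → X ≈ X' → Y ≈ Y' → (X ⊃ Y) ≈ (X' ⊃ Y')
  ≈-⊃ e f = ≈-~ (≈-& e (≈-~ f))

  ≈-∨ : ∀ {X X' Y Y'} → X ≈ X' → Y ≈ Y' → (X ∨ Y) ≈ (X' ∨ Y')
  ≈-∨ e f = ≈-~ (≈-& (≈-~ e) (≈-~ f))

  ≈-Δ : ∀ {X Y} → X ≈ Y → Δ X ≈ Δ Y
  ≈-Δ = re

  ≈-transportˡ : ∀ {X Y} → X ≈ Y → ⊢ Y → ⊢ X
  ≈-transportˡ {X} {Y} e y = mp y (mp e (tautology
    (taut-instance ((p₀ ⇔ₚ p₁) ⇒ₚ p₁ ⇒ₚ p₀) (X ∷ Y ∷ []) tt)))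

  _≈⁺_ : List⁺ Fm → List⁺ Fm → Set
  Cs ≈⁺ Ds = Pointwise _≈_ (toList Cs) (toList Ds)

  conj-cong : ∀ {Cs Ds} → Cs ≈⁺ Ds → conj Cs ≈ conj Ds
  conj-cong {_ List⁺.∷ []}     (e ∷ [])    = e
  conj-cong {_ List⁺.∷ _ ∷ _} (e ∷ f ∷ p) = ≈-& e (conj-cong (f ∷ p))

  choices-cong : ∀ {A A' As As'} → A ≈ A' → Pointwise _≈_ As As' →
    Pointwise _≈⁺_ (toList (choices A As)) (toList (choices A' As'))
  choices-cong e [] = (e ∷ []) ∷ (≈-~ e ∷ []) ∷ []
  choices-cong e (f ∷ p) =
    Pointwise.++⁺ (Pointwise.map⁺ _ _ (Pointwise.map (e ∷_) (choices-cong f p)))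
                  (Pointwise.map⁺ _ _ (Pointwise.map (≈-~ e ∷_) (choices-cong f p)))

  Dreduct-cong : ∀ {A A' As As' B B'} → A ≈ A' → Pointwise _≈_ As As' → B ≈ B' →
    Dreduct A As B ≈ Dreduct A' As' B'
  Dreduct-cong e p f = conj-cong (Pointwise.map⁺ _ _ (Pointwise.map decides-cong (choices-cong e p)))
    where
    decides-cong : ∀ {C C'} → C ≈⁺ C' → decides _ C ≈ decides _ C'
    decides-cong q = ≈-∨ (≈-Δ (≈-⊃ (conj-cong q) f)) (≈-Δ (≈-⊃ (conj-cong q) (≈-~ f)))

-- Translation of L_D into L_Δ

mutual
  tr : Fm → Fm
  tr (var p)         = var p
  tr (~ A)           = ~ tr A
  tr (A & B)         = tr A & tr B
  tr (D [] B)        = Δ (tr B)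
  tr (D (A ∷ As) B)  = Dreduct (tr A) (tr* As) (tr B)

  tr* : List Fm → List Fm
  tr* []       = []
  tr* (A ∷ As) = tr A ∷ tr* As

conj-InΔ : ∀ {Cs} → All InΔ (toList Cs) → InΔ (conj Cs)
conj-InΔ {_ List⁺.∷ []}     (c ∷ [])    = c
conj-InΔ {_ List⁺.∷ _ ∷ _} (c ∷ d ∷ p) = c & conj-InΔ (d ∷ p)

choices-InΔ : ∀ {A As} → InΔ A → All InΔ As → All (All InΔ ∘ toList) (toList (choices A As))
choices-InΔ a [] = (a ∷ []) ∷ (~ a ∷ []) ∷ []
choices-InΔ a (b ∷ p) =
  AllP.++⁺ (AllP.map⁺ (All.map (a ∷_) (choices-InΔ b p)))
           (AllP.map⁺ (All.map (~ a ∷_) (choices-InΔ b p)))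

Dreduct-InΔ : ∀ {A As B} → InΔ A → All InΔ As → InΔ B → InΔ (Dreduct A As B)
Dreduct-InΔ a p b = conj-InΔ (AllP.map⁺ (All.map decides-InΔ (choices-InΔ a p)))
  where
  decides-InΔ : ∀ {C} → All InΔ (toList C) → InΔ (decides _ C)
  decides-InΔ c = ~ (~ Δ∈ (~ (conj-InΔ c & ~ b)) & ~ Δ∈ (~ (conj-InΔ c & ~ ~ b)))

mutual
  tr-InΔ : ∀ X → InΔ (tr X)
  tr-InΔ (var p)        = var p
  tr-InΔ (~ A)          = ~ tr-InΔ A
  tr-InΔ (A & B)        = tr-InΔ A & tr-InΔ B
  tr-InΔ (D [] B)       = Δ∈ (tr-InΔ B)
  tr-InΔ (D (A ∷ As) B) = Dreduct-InΔ (tr-InΔ A) (tr*-InΔ As) (tr-InΔ B)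

  tr*-InΔ : ∀ As → All InΔ (tr* As)
  tr*-InΔ []       = []
  tr*-InΔ (A ∷ As) = tr-InΔ A ∷ tr*-InΔ As

module _ (L : Logic) where
  open Provable L

  mutual
    ≈-tr : ∀ X → X ≈ tr X
    ≈-tr (var p)        = ≈-refl
    ≈-tr (~ A)          = ≈-~ (≈-tr A)
    ≈-tr (A & B)        = ≈-& (≈-tr A) (≈-tr B)
    ≈-tr (D [] B)       = ≈-Δ (≈-tr B)
    ≈-tr (D (A ∷ As) B) =
      ≈-trans (ax (Dn refl A As B) tt) (Dreduct-cong (≈-tr A) (≈-tr* As) (≈-tr B))

    ≈-tr* : ∀ As → Pointwise _≈_ As (tr* As)
    ≈-tr* []       = []
    ≈-tr* (A ∷ As) = ≈-tr A ∷ ≈-tr* As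

-- Classical semantics

↔-cong : ∀ {P P' Q Q' : Set} → P ⇔ P' → Q ⇔ Q' → ((P → Q) × (Q → P)) ⇔ ((P' → Q') × (Q' → P'))
↔-cong p q = mk⇔ (λ (f , g) → to q ∘ f ∘ from p , to p ∘ g ∘ from q)
                 (λ (f , g) → from q ∘ f ∘ to p , from p ∘ g ∘ to q)

lookup-witness : ∀ {A : Set} {P Q : A → Set} {xs} → All P xs → Any Q xs → Σ A λ x → P x × Q x
lookup-witness ps q = Any.lookup q , All.lookupAny ps q

module Classical (lem : ExcludedMiddle 0ℓ) (fr : Frame) (V : Frame.W fr → ℕ → Set) where
  open Frame fr

  S : Fm → W → Set
  S = sat fr V

  stable : ∀ {P : Set} → ¬ ¬ P → P
  stable = decidable-stable lem

  ⊃-elim : ∀ {A B w} → S (A ⊃ B) w → S A w → S B w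
  ⊃-elim h a = stable (λ nb → h (a , nb))

  ⊃-intro : ∀ {A B w} → (S A w → S B w) → S (A ⊃ B) w
  ⊃-intro f (a , nb) = nb (f a)

  ≣-true : ∀ {A B w} → S (A ≣ B) w → S A w ⇔ S B w
  ≣-true {A} {B} (f , g) = mk⇔ (⊃-elim {A} {B} f) (⊃-elim {B} {A} g)

  ≣-true⁻ : ∀ {A B w} → S A w ⇔ S B w → S (A ≣ B) w
  ≣-true⁻ {A} {B} e = ⊃-intro {A} {B} (to e) , ⊃-intro {B} {A} (from e)

  Δ-intro : ∀ {X w} → (∀ x → R w x → S X x) → S (Δ X) w
  Δ-intro h u v wRu wRv _ = (λ _ → h v wRv) , (λ _ → h u wRu)

  taut-true : ∀ {X} w → Taut X → S X w
  taut-true {X} w t = toWitness (from T-≡ (t value value-~ value-&))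
    where
    value : Fm → Bool
    value B = isYes (lem {S B w})

    value-~ : ∀ B → value (~ B) ≡ not (value B)
    value-~ B with lem {S (~ B) w} | lem {S B w}
    ... | yes nb  | yes b  = ⊥-elim (nb b)
    ... | yes _   | no _   = refl
    ... | no _    | yes _  = refl
    ... | no nnb  | no nb  = ⊥-elim (nnb nb)

    value-& : ∀ B C → value (B & C) ≡ (value B ∧ value C)
    value-& B C with lem {S (B & C) w} | lem {S B w} | lem {S C w}
    ... | yes _       | yes _  | yes _  = refl
    ... | yes (_ , c) | yes _  | no nc  = ⊥-elim (nc c)
    ... | yes (b , _) | no nb  | _      = ⊥-elim (nb b)
    ... | no n        | yes b  | yes c  = ⊥-elim (n (b , c))
    ... | no _        | yes _  | no _   = refl
    ... | no _        | no _   | _      = refl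

  conj-true : ∀ {C Cs w} → S (conj (C List⁺.∷ Cs)) w → All (λ C → S C w) (C ∷ Cs)
  conj-true {Cs = []}    c       = c ∷ []
  conj-true {Cs = _ ∷ _} (c , d) = c ∷ conj-true d

  conj-true⁻ : ∀ {C Cs w} → All (λ C → S C w) (C ∷ Cs) → S (conj (C List⁺.∷ Cs)) w
  conj-true⁻ {Cs = []}    (c ∷ [])    = c
  conj-true⁻ {Cs = _ ∷ _} (c ∷ d ∷ p) = c , conj-true⁻ (d ∷ p)

  Choices : Fm → List Fm → (List⁺ Fm → Set) → Set
  Choices A As P = All P (toList (choices A As))

  choice-agree : ∀ A As →
    Choices A As (λ C → ∀ {u v} → S (conj C) u → S (conj C) v → agree fr V (A ∷ As) u v)
  choice-agree A [] =
    (λ a b → ((λ _ → b) , (λ _ → a)) , tt) ∷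
    (λ na nb → ((⊥-elim ∘ na) , (⊥-elim ∘ nb)) , tt) ∷ []
  choice-agree A (A' ∷ As) = AllP.++⁺
    (AllP.map⁺ (All.map (λ h {_} {_} (a , cu) (b , cv) → ((λ _ → b) , (λ _ → a)) , h cu cv)
                        (choice-agree A' As)))
    (AllP.map⁺ (All.map (λ h {_} {_} (na , cu) (nb , cv) → ((⊥-elim ∘ na) , (⊥-elim ∘ nb)) , h cu cv)
                        (choice-agree A' As)))

  choice-transfer : ∀ A As →
    Choices A As (λ C → ∀ {u v} → agree fr V (A ∷ As) u v → S (conj C) u → S (conj C) v)
  choice-transfer A [] = (λ ((f , _) , _) → f) ∷ (λ ((_ , g) , _) na → na ∘ g) ∷ []
  choice-transfer A (A' ∷ As) = AllP.++⁺
    (AllP.map⁺ (All.map (λ h {_} {_} ((f , _) , ag) (a , cu) → f a , h ag cu)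
                        (choice-transfer A' As)))
    (AllP.map⁺ (All.map (λ h {_} {_} ((_ , g) , ag) (na , cu) → na ∘ g , h ag cu)
                        (choice-transfer A' As)))

  choice-exists : ∀ A As u → Any (λ C → S (conj C) u) (toList (choices A As))
  choice-exists A [] u with lem {S A u}
  ... | yes a = here a
  ... | no na = there (here na)
  choice-exists A (A' ∷ As) u with lem {S A u}
  ... | yes a = AnyP.++⁺ˡ (AnyP.map⁺ {f = A List⁺.∷⁺_} (Any.map (a ,_) (choice-exists A' As u)))
  ... | no na = AnyP.++⁺ʳ (List.map (A List⁺.∷⁺_) (toList (choices A' As)))
    (AnyP.map⁺ {f = (~ A) List⁺.∷⁺_} (Any.map (na ,_) (choice-exists A' As u)))

  Decides : Fm → List⁺ Fm → W → Set
  Decides B C w = ∀ {u v} → R w u → R w v → S (conj C) u → S (conj C) v → S B u → S B v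

  decides-true : ∀ {B C w} → S (decides B C) w → Decides B C w
  decides-true d {u} {v} wRu wRv cu cv bu = stable λ nbv →
    d ((λ ΔB  → proj₁ (ΔB u v wRu wRv tt) (λ (_ , nbu) → nbu bu) (cv , nbv)) ,
       (λ Δ¬B → proj₂ (Δ¬B u v wRu wRv tt) (λ (_ , nnbv) → nnbv nbv) (cu , λ nbu → nbu bu)))

  decides-true⁻ : ∀ {B C w} → Decides B C w → S (decides B C) w
  decides-true⁻ {B} {C} {w} dec (¬always-B , ¬always-¬B)
    with lem {Σ W λ u → R w u × S (conj C) u × ¬ S B u}
  ... | yes (u , wRu , cu , nbu) =
    ¬always-¬B (Δ-intro {conj C ⊃ ~ B} λ x wRx → ⊃-intro {conj C} {~ B} λ cx bx →
      nbu (dec wRx wRu cx cu bx))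
  ... | no none =
    ¬always-B (Δ-intro {conj C ⊃ B} λ x wRx → ⊃-intro {conj C} {B} λ cx →
      stable λ nbx → none (x , wRx , cx , nbx))

  Dreduct-true : ∀ {A As B w} → S (Dreduct A As B) w → Choices A As (λ C → S (decides B C) w)
  Dreduct-true {B = B} = AllP.map⁻ {f = decides B} ∘ conj-true

  Dreduct-true⁻ : ∀ {A As B w} → Choices A As (λ C → S (decides B C) w) → S (Dreduct A As B) w
  Dreduct-true⁻ {B = B} = conj-true⁻ ∘ AllP.map⁺ {f = decides B}

  Dax-true : ∀ A As B w → S (Dax A As B) w
  Dax-true A As B w =
    ⊃-intro {D (A ∷ As) B} {Dreduct A As B} D⇒Dreduct ,
    ⊃-intro {Dreduct A As B} {D (A ∷ As) B} Dreduct⇒D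
    where
    D⇒Dreduct : S (D (A ∷ As) B) w → S (Dreduct A As B) w
    D⇒Dreduct hD = Dreduct-true⁻ {A} {As} {B} (All.map
      (λ {C} agrees → decides-true⁻ {B} {C} λ wRu wRv cu cv → proj₁ (hD _ _ wRu wRv (agrees cu cv)))
      (choice-agree A As))

    Dreduct⇒D : S (Dreduct A As B) w → S (D (A ∷ As) B) w
    Dreduct⇒D hR u v wRu wRv ag =
      let (C , (dec , transfer) , cu) =
            lookup-witness (All.zip (Dreduct-true {A} {As} {B} hR , choice-transfer A As))
                           (choice-exists A As u)
          cv = transfer ag cu
      in decides-true {B} {C} dec wRu wRv cu cv , decides-true {B} {C} dec wRv wRu cv cu

mutual
  sub : (ℕ → Fm) → Fm → Fm
  sub σ (var p)  = σ p
  sub σ (~ A)    = ~ sub σ A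
  sub σ (A & B)  = sub σ A & sub σ B
  sub σ (D As B) = D (sub* σ As) (sub σ B)

  sub* : (ℕ → Fm) → List Fm → List Fm
  sub* σ []       = []
  sub* σ (A ∷ As) = sub σ A ∷ sub* σ As

module _ (fr : Frame) (V : Frame.W fr → ℕ → Set) (σ : ℕ → Fm) where
  open Frame fr

  Vσ : W → ℕ → Set
  Vσ w p = sat fr V (σ p) w

  mutual
    sat-sub : ∀ φ w → sat fr Vσ φ w ⇔ sat fr V (sub σ φ) w
    sat-sub (var p)  w = ⇔.refl
    sat-sub (~ A)    w = mk⇔ (_∘ from (sat-sub A w)) (_∘ to (sat-sub A w))
    sat-sub (A & B)  w = sat-sub A w ×-⇔ sat-sub B w
    sat-sub (D As B) w = mk⇔
      (λ h u v wRu wRv ag →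
         to (↔-cong (sat-sub B u) (sat-sub B v)) (h u v wRu wRv (from (agree-sub As u v) ag)))
      (λ h u v wRu wRv ag →
         from (↔-cong (sat-sub B u) (sat-sub B v)) (h u v wRu wRv (to (agree-sub As u v) ag)))

    agree-sub : ∀ As u v → agree fr Vσ As u v ⇔ agree fr V (sub* σ As) u v
    agree-sub []       u v = ⇔.refl
    agree-sub (A ∷ As) u v = ↔-cong (sat-sub A u) (sat-sub A v) ×-⇔ agree-sub As u v

σ₃ : Fm → Fm → Fm → ℕ → Fm
σ₃ A B C 0 = A
σ₃ A B C 1 = B
σ₃ A B C 2 = C
σ₃ A B C p = var p

v₀ v₁ v₂ : Fm
v₀ = var 0
v₁ = var 1
v₂ = var 2

isΔ : Fm → Bool
isΔ (var p)       = true
isΔ (~ A)         = isΔ A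
isΔ (A & B)       = isΔ A ∧ isΔ B
isΔ (D [] B)      = isΔ B
isΔ (D (_ ∷ _) B) = false

isΔ-sound : ∀ φ → Tᵇ (isΔ φ) → InΔ φ
isΔ-sound (var p)  h = var p
isΔ-sound (~ A)    h = ~ isΔ-sound A h
isΔ-sound (A & B)  h = isΔ-sound A (proj₁ (to T-∧ h)) & isΔ-sound B (proj₂ (to T-∧ h))
isΔ-sound (D [] B) h = Δ∈ (isΔ-sound B h)
isΔ-sound (D (_ ∷ _) B) ()

Thm-Δ⇒D : ∀ {L X} → Thm L false X → Thm L true X
Thm-Δ⇒D (ax a _) = ax (Ax-Δ⇒D a) tt
  where
  Ax-Δ⇒D : ∀ {L X} → Ax L false X → Ax L true X
  Ax-Δ⇒D (taut t)     = taut t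
  Ax-Δ⇒D (k1 A B)     = k1 A B
  Ax-Δ⇒D (k2 A B C)   = k2 A B C
  Ax-Δ⇒D (k3 A)       = k3 A
  Ax-Δ⇒D (T h A B)    = T h A B
  Ax-Δ⇒D (A4 h A B)   = A4 h A B
  Ax-Δ⇒D (A5 h A B)   = A5 h A B
  Ax-Δ⇒D (AB h A B C) = AB h A B C
  Ax-Δ⇒D (A4' h A)    = A4' h A
  Ax-Δ⇒D (A5' h A)    = A5' h A
  Ax-Δ⇒D (Dn () _ _ _)
Thm-Δ⇒D (mp t u) = mp (Thm-Δ⇒D t) (Thm-Δ⇒D u)
Thm-Δ⇒D (nec t)  = nec (Thm-Δ⇒D t)
Thm-Δ⇒D (re t)   = re (Thm-Δ⇒D t)

module Transfer (lem : ExcludedMiddle 0ℓ) (L : Logic) (F : Frame → Set₁)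
                (SΔ-adequate : SoundStrongComplΔ L F) where
  open Provable L
  open Classical lem using (⊃-elim; ≣-true; ≣-true⁻; Δ-intro; taut-true; Dax-true)

  Valid : Fm → Set₁
  Valid X = ∀ fr → F fr → ∀ V w → sat fr V X w

  Δ-axiom-valid : ∀ φ → Tᵇ (isΔ φ) → Ax L false φ → ∀ σ → Valid (sub σ φ)
  Δ-axiom-valid φ isΔφ a σ fr Ffr V w =
    to (sat-sub fr V σ φ w)
       (to (SΔ-adequate (λ _ → ⊥) φ (λ _ ()) φ∈Δ) ([] , [] , ax a φ∈Δ)
           fr Ffr (Vσ fr V σ) w λ _ ())
    where
    φ∈Δ : InΔ φ
    φ∈Δ = isΔ-sound φ isΔφ

  axiom-valid : ∀ {X} → Ax L true X → Valid X
  axiom-valid (taut t) fr _ V w = taut-true fr V w t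
  axiom-valid (k1 A B) = Δ-axiom-valid ((Δ (v₀ ⊃ v₁) & Δ (~ v₀ ⊃ v₁)) ⊃ Δ v₁) tt (k1 _ _) (σ₃ A B A)
  axiom-valid (k2 A B C) = Δ-axiom-valid (Δ v₀ ⊃ (Δ (v₀ ⊃ v₁) ∨ Δ (~ v₀ ⊃ v₂))) tt (k2 _ _ _) (σ₃ A B C)
  axiom-valid (k3 A) = Δ-axiom-valid (Δ v₀ ≣ Δ (~ v₀)) tt (k3 _) (σ₃ A A A)
  axiom-valid (T h A B) = Δ-axiom-valid (((Δ v₀ & Δ (v₀ ⊃ v₁)) & v₀) ⊃ Δ v₁) tt (T h _ _) (σ₃ A B A)
  axiom-valid (A4 h A B) = Δ-axiom-valid (Δ v₀ ⊃ Δ (Δ v₀ ∨ v₁)) tt (A4 h _ _) (σ₃ A B A)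
  axiom-valid (A5 h A B) = Δ-axiom-valid (~ Δ v₀ ⊃ Δ (~ Δ v₀ ∨ v₁)) tt (A5 h _ _) (σ₃ A B A)
  axiom-valid (AB h A B C) =
    Δ-axiom-valid (v₀ ⊃ Δ (((Δ v₀ & Δ (v₀ ⊃ v₁)) & ~ Δ v₁) ⊃ v₂)) tt (AB h _ _ _) (σ₃ A B C)
  axiom-valid (A4' h A) = Δ-axiom-valid (Δ v₀ ⊃ Δ (Δ v₀)) tt (A4' h _) (σ₃ A A A)
  axiom-valid (A5' h A) = Δ-axiom-valid (~ Δ v₀ ⊃ Δ (~ Δ v₀)) tt (A5' h _) (σ₃ A A A)
  axiom-valid (Dn _ A As B) fr _ V w = Dax-true fr V A As B w

  theorem-valid : ∀ {X} → ⊢ X → Valid X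
  theorem-valid (ax a _) = axiom-valid a
  theorem-valid (mp {A} {B} a a⊃b) fr Ffr V w =
    ⊃-elim fr V {A} {B} (theorem-valid a⊃b fr Ffr V w) (theorem-valid a fr Ffr V w)
  theorem-valid (nec {A} a) fr Ffr V w = Δ-intro fr V {A} λ x _ → theorem-valid a fr Ffr V x
  theorem-valid (re {A} {B} a≣b) fr Ffr V w =
    ≣-true⁻ fr V {Δ A} {Δ B} (mk⇔
      (λ ΔA u v wRu wRv _ → to (↔-cong (A⇔B u) (A⇔B v)) (ΔA u v wRu wRv tt))
      (λ ΔB u v wRu wRv _ → from (↔-cong (A⇔B u) (A⇔B v)) (ΔB u v wRu wRv tt)))
    where
    A⇔B : ∀ x → sat fr V A x ⇔ sat fr V B x
    A⇔B x = ≣-true fr V {A} {B} (theorem-valid a≣b fr Ffr V x)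

  ≈-valid : ∀ {X Y} → X ≈ Y → ∀ fr → F fr → ∀ V w → sat fr V X w ⇔ sat fr V Y w
  ≈-valid {X} {Y} e fr Ffr V w = ≣-true fr V {X} {Y} (theorem-valid e fr Ffr V w)

  sound : ∀ Γ A → Der L true Γ A → Γ ⊨[ F ] A
  sound Γ A (Γ₀ , Γ₀⊆Γ , ⊢Γ₀⊃A) fr Ffr V w Γ-true =
    discharge Γ₀ Γ₀⊆Γ (theorem-valid ⊢Γ₀⊃A fr Ffr V w)
    where
    discharge : ∀ Γ₀ → All Γ Γ₀ → sat fr V (foldr _⊃_ A Γ₀) w → sat fr V A w
    discharge []       []       a = a
    discharge (B ∷ Bs) (b ∷ bs) h =
      discharge Bs bs (⊃-elim fr V {B} {foldr _⊃_ A Bs} h (Γ-true B b))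

  complete : ∀ Γ A → Γ ⊨[ F ] A → Der L true Γ A
  complete Γ A Γ⊨A =
    let (Θ₀ , Θ₀⊆trΓ , ⊢Θ₀⊃trA) = from (SΔ-adequate trΓ (tr A) trΓ-InΔ (tr-InΔ A)) trΓ⊨trA
        (Γ₀ , Γ₀⊆Γ , Γ₀⊃A≈Θ₀⊃trA) = untranslate Θ₀ Θ₀⊆trΓ
    in Γ₀ , Γ₀⊆Γ , ≈-transportˡ Γ₀⊃A≈Θ₀⊃trA (Thm-Δ⇒D ⊢Θ₀⊃trA)
    where
    trΓ : Fm → Set
    trΓ φ = Σ Fm λ B → Γ B × tr B ≡ φ

    trΓ-InΔ : ∀ φ → trΓ φ → InΔ φ
    trΓ-InΔ _ (B , _ , refl) = tr-InΔ B

    trΓ⊨trA : trΓ ⊨[ F ] tr A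
    trΓ⊨trA fr Ffr V w trΓ-true = to (≈-valid (≈-tr L A) fr Ffr V w)
      (Γ⊨A fr Ffr V w λ B b → from (≈-valid (≈-tr L B) fr Ffr V w) (trΓ-true (tr B) (B , b , refl)))

    untranslate : ∀ Θ₀ → All trΓ Θ₀ →
      Σ (List Fm) λ Γ₀ → All Γ Γ₀ × foldr _⊃_ A Γ₀ ≈ foldr _⊃_ (tr A) Θ₀
    untranslate []       []                 = [] , [] , ≈-tr L A
    untranslate (_ ∷ Θ₀) ((B , b , refl) ∷ bs) =
      let (Γ₀ , Γ₀⊆Γ , e) = untranslate Θ₀ bs in B ∷ Γ₀ , b ∷ Γ₀⊆Γ , ≈-⊃ (≈-tr L B) e

theorem6p10 : ExcludedMiddle 0ℓ → (L : Logic) (F : Frame → Set₁) →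
    SoundStrongComplΔ L F → SoundStrongComplD L F
theorem6p10 lem L F SΔ Γ A = mk⇔ (sound Γ A) (complete Γ A)
  where open Transfer lem L F SΔ
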